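{- Let $N\in\mathbb{N}$ and let $r$ be an odd prime with $\gcd(N,r)=1$. Then \[ |\mathcal{L}_{N,r}|=\begin{cases}(r+1)/2 & \text{if } (N|r)=1,\\ (r-1)/2 & \text{if } (N|r)=-1,\end{cases} \] where $(N|r)$ denotes the Legendre symbol.
   Context: For $N,m\in\mathbb{N}$ with $\gcd(N,m)=1$, let $\mathcal{H}_{N,m}:=\{(x,y)\in(\mathbb{Z}/m\mathbb{Z})^2: N\equiv xy \bmod m\}$ and $\mathcal{L}_{N,m}:=\{x+y \bmod m : (x,y)\in\mathcal{H}_{N,m}\}\subseteq\mathbb{Z}/m\mathbb{Z}$. -}

module Defs where

open import Data.Nat using (ℕ; zero; suc; _+_; _*_; _%_; NonZero)
open import Data.Nat.Primality using (Prime)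
open import Data.Fin using (Fin; toℕ)
open import Data.Fin.Properties using (any?)
open import Data.Fin.Subset using (Subset)
import Data.Vec as Vec
open import Data.Bool using (Bool)
open import Data.Product using (∃; ∃₂; _×_; _,_)
open import Data.Integer using (ℤ; 0ℤ; 1ℤ; -1ℤ)
open import Relation.Nullary using (Dec; yes; no; does)
open import Relation.Binary.PropositionalEquality using (_≡_)
import Data.Nat.Properties as ℕP
open import Data.Product.Properties using (≡-dec)

-- Residues mod m are represented by Fin m (canonical reps 0..m-1);
-- ring operations are performed on representatives and reduced mod m.

InH : (N m : ℕ) .{{_ : NonZero m}} → Fin m → Fin m → Set
InH N m x y = (toℕ x * toℕ y) % m ≡ N % m

InL : (N m : ℕ) .{{_ : NonZero m}} → Fin m → Set
InL N m z = ∃₂ λ (x y : Fin m) → InH N m x y × ((toℕ x + toℕ y) % m ≡ toℕ z)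

InL? : (N m : ℕ) .{{_ : NonZero m}} → (z : Fin m) → Dec (InL N m z)
InL? N m z = any? λ x → any? λ y →
  let d1 = ((toℕ x * toℕ y) % m) ℕP.≟ (N % m)
      d2 = ((toℕ x + toℕ y) % m) ℕP.≟ toℕ z
  in Relation.Nullary.Decidable._×-dec_ d1 d2
  where import Relation.Nullary.Decidable

Lset : (N m : ℕ) .{{_ : NonZero m}} → Subset m
Lset N m = Vec.tabulate (λ z → does (InL? N m z))

IsQR : (N m : ℕ) .{{_ : NonZero m}} → Set
IsQR N m = ∃ λ (x : Fin m) → (toℕ x * toℕ x) % m ≡ N % m

IsQR? : (N m : ℕ) .{{_ : NonZero m}} → Dec (IsQR N m)
IsQR? N m = any? λ x → ((toℕ x * toℕ x) % m) ℕP.≟ (N % m)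

legendre : (N p : ℕ) .{{_ : NonZero p}} → ℤ
legendre N p with N % p ℕP.≟ 0
... | yes _ = 0ℤ
... | no _ with IsQR? N p
...   | yes _ = 1ℤ
...   | no _ = -1ℤ

-- Double counting. Cut 𝓗 = {(x , y) : x y ≡ N} into the fibres F_z = {(x , y) ∈ 𝓗 : x + y ≡ z}.
-- The points of a fibre are pairs of roots of t² − z t + N, so a nonempty fibre is
-- {(x₀ , y₀) , (y₀ , x₀)} and, writing D_z for its points on the diagonal x = y,
-- |F_z| + |D_z| is 2 if z ∈ 𝓛 and 0 otherwise. Summing over z,
-- 2 |𝓛| = |𝓗| + #{x : x² ≡ N} = (r − 1) + (1 + (N|r)): every nonzero x has exactly one
-- partner y = N / x, and N has either no square roots or exactly two, ±x₀, which are
-- distinct because r is odd.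
module Submission where

open import Defs
import Algebra.Properties.CommutativeMonoid.Sum as MonoidSum
open import Data.Fin using (Fin; zero; suc; toℕ; fromℕ<; _≟_)
open import Data.Fin.Properties using (suc-injective; toℕ-injective; toℕ<n; toℕ-fromℕ<; any?)
import Data.Fin.Subset
open import Data.Integer using (ℤ; +_; 0ℤ; 1ℤ; -1ℤ)
import Data.Integer.Properties as ℤP
open import Data.Integer.DivMod using (_%ℕ_; _/ℕ_; n%ℕd<d; a≡a%ℕn+[a/ℕn]*n)
open import Data.Integer.Divisibility.Signed
  using (_∣_; divides; _∣?_; ∣⇒∣ᵤ; ∣ᵤ⇒∣; ∣m∣n⇒∣m+n; ∣m⇒∣-m; ∣n⇒∣m*n)
open import Data.Integer.Tactic.RingSolver using (solve; solve-∀)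
open import Data.List using ([]; _∷_)
open import Data.Nat using (ℕ; zero; suc; NonZero; _%_; _/_; _<_)
import Data.Nat as ℕ
import Data.Nat.Divisibility as ℕ
import Data.Nat.Properties as ℕP
open import Data.Nat.Coprimality using (prime⇒coprime; coprime-Bézout)
open import Data.Nat.DivMod using (m≡m%n+[m/n]*n; m%n<n; m<n⇒m%n≡m; m*n/n≡m)
open import Data.Nat.GCD using (gcd; gcd-greatest; module Bézout)
open import Data.Nat.Primality using (Prime; prime⇒nonZero; prime⇒nonTrivial; euclidsLemma)
open import Data.Product using (∃; _×_; _,_; proj₂)
open import Data.Sum using (_⊎_; inj₁; inj₂; [_,_]′)
import Data.Sum as Sum
open import Data.Unit using (tt)
open import Data.Vec using (tabulate)
open import Function using (id; _∘_)
open import Level using (Level)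
open import Relation.Binary using (IsEquivalence; Setoid)
open import Relation.Binary.PropositionalEquality hiding ([_])
import Relation.Binary.Reasoning.Setoid as ≈-Reasoning
open import Relation.Nullary using (Dec; yes; no; does; ¬_; ¬?; _×-dec_; _⊎-dec_; contradiction)
open import Relation.Nullary.Decidable using (map′)
open import Relation.Unary using (Pred; Decidable)

module Congruence (p : ℕ) .{{_ : NonZero p}} where

  open Data.Integer using (-_; _+_; _-_; _*_; ∣_∣; _⊖_)

  infix 4 _≋_ _≋?_

  -- A record rather than a synonym for + p ∣ a - b, so that a and b can be inferred from a proof.
  record _≋_ (a b : ℤ) : Set where
    constructor ∣⇒≋
    field ≋⇒∣ : + p ∣ a - b

  open _≋_ public

  _≋?_ : ∀ a b → Dec (a ≋ b)
  a ≋? b = map′ ∣⇒≋ ≋⇒∣ (+ p ∣? a - b)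

  ∣-respʳ : ∀ {a b} → a ≡ b → + p ∣ a → + p ∣ b
  ∣-respʳ = subst (+ p ∣_)

  ≡⇒≋ : ∀ {a b} → a ≡ b → a ≋ b
  ≡⇒≋ {a} refl = ∣⇒≋ (divides 0ℤ (ℤP.+-inverseʳ a))

  ≋-refl : ∀ {a} → a ≋ a
  ≋-refl = ≡⇒≋ refl

  ≋-sym : ∀ {a b} → a ≋ b → b ≋ a
  ≋-sym {a} {b} (∣⇒≋ p∣a-b) = ∣⇒≋ (∣-respʳ { - (a - b)} (solve (a ∷ b ∷ [])) (∣m⇒∣-m p∣a-b))

  ≋-trans : ∀ {a b c} → a ≋ b → b ≋ c → a ≋ c
  ≋-trans {a} {b} {c} (∣⇒≋ p∣a-b) (∣⇒≋ p∣b-c) =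
    ∣⇒≋ (∣-respʳ {(a - b) + (b - c)} (solve (a ∷ b ∷ c ∷ [])) (∣m∣n⇒∣m+n p∣a-b p∣b-c))

  ≋-isEquivalence : IsEquivalence _≋_
  ≋-isEquivalence = record { refl = ≋-refl ; sym = ≋-sym ; trans = ≋-trans }

  ≋-setoid : Setoid _ _
  ≋-setoid = record { isEquivalence = ≋-isEquivalence }

  +-cong : ∀ {a b c d} → a ≋ b → c ≋ d → a + c ≋ b + d
  +-cong {a} {b} {c} {d} (∣⇒≋ p∣a-b) (∣⇒≋ p∣c-d) =
    ∣⇒≋ (∣-respʳ {(a - b) + (c - d)} (solve (a ∷ b ∷ c ∷ d ∷ [])) (∣m∣n⇒∣m+n p∣a-b p∣c-d))

  -‿cong : ∀ {a b} → a ≋ b → - a ≋ - b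
  -‿cong {a} {b} (∣⇒≋ p∣a-b) = ∣⇒≋ (∣-respʳ { - (a - b)} (solve (a ∷ b ∷ [])) (∣m⇒∣-m p∣a-b))

  *-cong : ∀ {a b c d} → a ≋ b → c ≋ d → a * c ≋ b * d
  *-cong {a} {b} {c} {d} (∣⇒≋ p∣a-b) (∣⇒≋ p∣c-d) = ∣⇒≋ (∣-respʳ {c * (a - b) + b * (c - d)}
    (solve (a ∷ b ∷ c ∷ d ∷ [])) (∣m∣n⇒∣m+n (∣n⇒∣m*n c p∣a-b) (∣n⇒∣m*n b p∣c-d)))

  +-cancelˡ-≋ : ∀ {a b c} → a + b ≋ a + c → b ≋ c
  +-cancelˡ-≋ {a} {b} {c} a+b≋a+c = begin
    b              ≡⟨ solve (a ∷ b ∷ []) ⟩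
    - a + (a + b)  ≈⟨ +-cong (≋-refl { - a}) a+b≋a+c ⟩
    - a + (a + c)  ≡⟨ solve (a ∷ c ∷ []) ⟩
    c              ∎
    where open ≈-Reasoning ≋-setoid

  ≋0⇒∣ : ∀ {a} → a ≋ 0ℤ → + p ∣ a
  ≋0⇒∣ {a} (∣⇒≋ p∣a-0) = ∣-respʳ (ℤP.+-identityʳ a) p∣a-0

  ∣⇒≋0 : ∀ {a} → + p ∣ a → a ≋ 0ℤ
  ∣⇒≋0 {a} p∣a = ∣⇒≋ (∣-respʳ (sym (ℤP.+-identityʳ a)) p∣a)

  -≋0⇒≋ : ∀ {a b} → a - b ≋ 0ℤ → a ≋ b
  -≋0⇒≋ = ∣⇒≋ ∘ ≋0⇒∣

  ≋⇒-≋0 : ∀ {a b} → a ≋ b → a - b ≋ 0ℤ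
  ≋⇒-≋0 = ∣⇒≋0 ∘ ≋⇒∣

  a+k*p≋a : ∀ a k → a + k * + p ≋ a
  a+k*p≋a a k = ∣⇒≋ (divides k (a+km-a≡km a k (+ p)))
    where
    a+km-a≡km : ∀ a k m → a + k * m - a ≡ k * m
    a+km-a≡km = solve-∀

  n%p≋n : ∀ n → + (n % p) ≋ + n
  n%p≋n n = begin
    + (n % p)                    ≈⟨ a+k*p≋a (+ (n % p)) (+ (n / p)) ⟨
    + (n % p) + + (n / p) * + p  ≡⟨ cong (_+_ (+ (n % p))) (ℤP.pos-* (n / p) p) ⟨
    + (n % p) + + (n / p ℕ.* p)  ≡⟨ ℤP.pos-+ (n % p) (n / p ℕ.* p) ⟨
    + (n % p ℕ.+ n / p ℕ.* p)    ≡⟨ cong +_ (m≡m%n+[m/n]*n n p) ⟨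
    + n                          ∎
    where open ≈-Reasoning ≋-setoid

  p∣i∧∣i∣<p⇒i≡0 : ∀ {i} → + p ∣ i → ∣ i ∣ < p → i ≡ 0ℤ
  p∣i∧∣i∣<p⇒i≡0 {i} p∣i ∣i∣<p with ∣ i ∣ in ∣i∣≡
  ... | zero = ℤP.∣i∣≡0⇒i≡0 ∣i∣≡
  ... | suc _ = contradiction (subst (p ℕ.∣_) ∣i∣≡ (∣⇒∣ᵤ p∣i)) (ℕ.>⇒∤ ∣i∣<p)

  +-≋-injective : ∀ {m n} → m < p → n < p → + m ≋ + n → m ≡ n
  +-≋-injective {m} {n} m<p n<p (∣⇒≋ p∣m-n) =
    ℤP.+-injective (ℤP.i-j≡0⇒i≡j (+ m) (+ n) (p∣i∧∣i∣<p⇒i≡0 p∣m-n ∣m-n∣<p))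
    where
    ∣m-n∣<p : ∣ + m - + n ∣ < p
    ∣m-n∣<p = begin-strict
      ∣ + m - + n ∣  ≡⟨ cong ∣_∣ (ℤP.m-n≡m⊖n m n) ⟩
      ∣ m ⊖ n ∣      ≤⟨ ℤP.∣m⊝n∣≤m⊔n m n ⟩
      m ℕ.⊔ n        <⟨ ℕP.⊔-lub m<p n<p ⟩
      p              ∎
      where open ℕP.≤-Reasoning

  %≡%⇒≋ : ∀ {m n} → m % p ≡ n % p → + m ≋ + n
  %≡%⇒≋ {m} {n} m%p≡n%p = ≋-trans (≋-sym (n%p≋n m)) (≋-trans (≡⇒≋ (cong +_ m%p≡n%p)) (n%p≋n n))

  ≋⇒%≡% : ∀ {m n} → + m ≋ + n → m % p ≡ n % p
  ≋⇒%≡% {m} {n} m≋n =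
    +-≋-injective (m%n<n m p) (m%n<n n p) (≋-trans (n%p≋n m) (≋-trans m≋n (≋-sym (n%p≋n n))))

  ⟦_⟧ : Fin p → ℤ
  ⟦ x ⟧ = + toℕ x

  [_] : ℤ → Fin p
  [ a ] = fromℕ< (n%ℕd<d a p)

  ⟦[a]⟧≋a : ∀ a → ⟦ [ a ] ⟧ ≋ a
  ⟦[a]⟧≋a a = begin
    ⟦ [ a ] ⟧                    ≡⟨ cong +_ (toℕ-fromℕ< (n%ℕd<d a p)) ⟩
    + (a %ℕ p)                   ≈⟨ a+k*p≋a (+ (a %ℕ p)) (a /ℕ p) ⟨
    + (a %ℕ p) + (a /ℕ p) * + p  ≡⟨ a≡a%ℕn+[a/ℕn]*n a p ⟨
    a                            ∎
    where open ≈-Reasoning ≋-setoid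

  ⟦⟧-injective : ∀ {x y} → ⟦ x ⟧ ≋ ⟦ y ⟧ → x ≡ y
  ⟦⟧-injective {x} {y} = toℕ-injective ∘ +-≋-injective (toℕ<n x) (toℕ<n y)

module PrimeCongruence {p : ℕ} (p-prime : Prime p) where

  open Data.Integer using (-_; _+_; _-_; _*_; ∣_∣)

  instance
    p≢0 : NonZero p
    p≢0 = prime⇒nonZero p-prime

  open Congruence p public

  *≋0⇒ : ∀ {a b} → a * b ≋ 0ℤ → a ≋ 0ℤ ⊎ b ≋ 0ℤ
  *≋0⇒ {a} {b} ab≋0 =
    Sum.map (∣⇒≋0 ∘ ∣ᵤ⇒∣) (∣⇒≋0 ∘ ∣ᵤ⇒∣)
      (euclidsLemma ∣ a ∣ ∣ b ∣ p-prime (subst (p ℕ.∣_) (ℤP.abs-* a b) (∣⇒∣ᵤ (≋0⇒∣ ab≋0))))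

  two-roots : ∀ {a b c} → (a - b) * (a - c) ≋ 0ℤ → a ≋ b ⊎ a ≋ c
  two-roots = Sum.map -≋0⇒≋ -≋0⇒≋ ∘ *≋0⇒

  *-cancelˡ-≋ : ∀ {a b c} → ¬ (a ≋ 0ℤ) → a * b ≋ a * c → b ≋ c
  *-cancelˡ-≋ {a} {b} {c} a≄0 ab≋ac =
    [ (λ a≋0 → contradiction a≋0 a≄0) , -≋0⇒≋ ]′ (*≋0⇒ (begin
      a * (b - c)    ≡⟨ solve (a ∷ b ∷ c ∷ []) ⟩
      a * b - a * c  ≈⟨ ≋⇒-≋0 ab≋ac ⟩
      0ℤ             ∎))
    where open ≈-Reasoning ≋-setoid

  vieta : ∀ {a b a₀ b₀} → a + b ≋ a₀ + b₀ → a * b ≋ a₀ * b₀ → a ≋ a₀ ⊎ a ≋ b₀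
  vieta {a} {b} {a₀} {b₀} sum≋ product≋ = two-roots (begin
    (a - a₀) * (a - b₀)              ≡⟨ solve (a ∷ a₀ ∷ b₀ ∷ []) ⟩
    a * a - a * (a₀ + b₀) + a₀ * b₀  ≈⟨ +-cong (+-cong (≋-refl {a * a}) (-‿cong (*-cong (≋-refl {a}) sum≋))) product≋ ⟨
    a * a - a * (a + b) + a * b      ≡⟨ solve (a ∷ b ∷ []) ⟩
    0ℤ                               ∎)
    where open ≈-Reasoning ≋-setoid

  square-roots : ∀ {a b} → a * a ≋ b * b → a ≋ b ⊎ a ≋ - b
  square-roots {a} {b} a²≋b² = two-roots (begin
    (a - b) * (a - - b)  ≡⟨ solve (a ∷ b ∷ []) ⟩
    a * a - b * b        ≈⟨ ≋⇒-≋0 a²≋b² ⟩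
    0ℤ                   ∎)
    where open ≈-Reasoning ≋-setoid

  1+a*b≡c*d⇒ℤ : ∀ a b c d → 1 ℕ.+ a ℕ.* b ≡ c ℕ.* d → 1ℤ + + a * + b ≡ + c * + d
  1+a*b≡c*d⇒ℤ a b c d eq = begin
    1ℤ + + a * + b     ≡⟨ cong (_+_ 1ℤ) (ℤP.pos-* a b) ⟨
    1ℤ + + (a ℕ.* b)   ≡⟨ ℤP.pos-+ 1 (a ℕ.* b) ⟨
    + (1 ℕ.+ a ℕ.* b)  ≡⟨ cong +_ eq ⟩
    + (c ℕ.* d)        ≡⟨ ℤP.pos-* c d ⟩
    + c * + d          ∎
    where open ≡-Reasoning

  ⟦⟧-invertible : ∀ x → ¬ (⟦ x ⟧ ≋ 0ℤ) → ∃ λ k → ⟦ x ⟧ * k ≋ 1ℤ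
  ⟦⟧-invertible x x≄0 with coprime-Bézout (prime⇒coprime p-prime {{ℕ.≢-nonZero x≢0}} (toℕ<n x))
    where
    x≢0 : toℕ x ≢ 0
    x≢0 x≡0 = x≄0 (≡⇒≋ (cong +_ x≡0))
  ... | Bézout.+- u v 1+vx≡up = - + v , (begin
    ⟦ x ⟧ * - + v            ≡⟨ a*-b≡1-[1+b*a] ⟦ x ⟧ (+ v) ⟩
    1ℤ - (1ℤ + + v * ⟦ x ⟧)  ≡⟨ cong (_-_ 1ℤ) (1+a*b≡c*d⇒ℤ v (toℕ x) u p 1+vx≡up) ⟩
    1ℤ - + u * + p           ≡⟨ cong (_+_ 1ℤ) (ℤP.neg-distribˡ-* (+ u) (+ p)) ⟩
    1ℤ + - + u * + p         ≈⟨ a+k*p≋a 1ℤ (- + u) ⟩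
    1ℤ                       ∎)
    where
    open ≈-Reasoning ≋-setoid
    a*-b≡1-[1+b*a] : ∀ a b → a * - b ≡ 1ℤ - (1ℤ + b * a)
    a*-b≡1-[1+b*a] = solve-∀
  ... | Bézout.-+ u v 1+up≡vx = + v , (begin
    ⟦ x ⟧ * + v     ≡⟨ ℤP.*-comm ⟦ x ⟧ (+ v) ⟩
    + v * ⟦ x ⟧     ≡⟨ 1+a*b≡c*d⇒ℤ u p v (toℕ x) 1+up≡vx ⟨
    1ℤ + + u * + p  ≈⟨ a+k*p≋a 1ℤ (+ u) ⟩
    1ℤ              ∎)
    where open ≈-Reasoning ≋-setoid

  odd⇒2≄0 : p % 2 ≡ 1 → ¬ (+ 2 ≋ 0ℤ)
  odd⇒2≄0 p-odd 2≋0 = contradiction (+-≋-injective 2<p (ℕ.>-nonZero⁻¹ p) 2≋0) λ ()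
    where
    2≢p : 2 ≢ p
    2≢p 2≡p = contradiction (trans (cong (_% 2) 2≡p) p-odd) λ ()
    2<p : 2 < p
    2<p = ℕP.≤∧≢⇒< (ℕ.nonTrivial⇒n>1 p {{prime⇒nonTrivial p-prime}}) 2≢p

  a≋-a⇒a≋0 : p % 2 ≡ 1 → ∀ {a} → a ≋ - a → a ≋ 0ℤ
  a≋-a⇒a≋0 p-odd {a} a≋-a =
    [ (λ 2≋0 → contradiction 2≋0 (odd⇒2≄0 p-odd)) , id ]′ (*≋0⇒ (begin
      + 2 * a  ≡⟨ solve (a ∷ []) ⟩
      a - - a  ≈⟨ ≋⇒-≋0 a≋-a ⟩
      0ℤ       ∎))
    where open ≈-Reasoning ≋-setoid

  gcd≡1⇒≄0 : ∀ {N} → gcd N p ≡ 1 → ¬ (+ N ≋ 0ℤ)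
  gcd≡1⇒≄0 gcd≡1 N≋0 = ℕ.nonTrivial⇒≢1 {{prime⇒nonTrivial p-prime}}
    (ℕ.∣1⇒≡1 (subst (p ℕ.∣_) gcd≡1 (gcd-greatest (∣⇒∣ᵤ (≋0⇒∣ N≋0)) ℕ.∣-refl)))

module Hyperbola {p : ℕ} (p-prime : Prime p) (N : ℕ) where

  open Data.Integer using (-_; _+_; _*_)
  open PrimeCongruence p-prime

  OnLine : Fin p → Fin p → Fin p → Set
  OnLine z x y = (toℕ x ℕ.+ toℕ y) % p ≡ toℕ z

  -- InL N p z unfolds to ∃₂ (Fibre z).
  Fibre : Fin p → Fin p → Fin p → Set
  Fibre z x y = InH N p x y × OnLine z x y

  InH? : ∀ x y → Dec (InH N p x y)
  InH? x y = (toℕ x ℕ.* toℕ y) % p ℕP.≟ N % p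

  Fibre? : ∀ z x y → Dec (Fibre z x y)
  Fibre? z x y = InH? x y ×-dec ((toℕ x ℕ.+ toℕ y) % p ℕP.≟ toℕ z)

  InH⇒≋ : ∀ x y → InH N p x y → ⟦ x ⟧ * ⟦ y ⟧ ≋ + N
  InH⇒≋ x y h = ≋-trans (≡⇒≋ (sym (ℤP.pos-* (toℕ x) (toℕ y)))) (%≡%⇒≋ h)

  ≋⇒InH : ∀ x y → ⟦ x ⟧ * ⟦ y ⟧ ≋ + N → InH N p x y
  ≋⇒InH x y xy≋N = ≋⇒%≡% (≋-trans (≡⇒≋ (ℤP.pos-* (toℕ x) (toℕ y))) xy≋N)

  OnLine⇒≋ : ∀ z x y → OnLine z x y → ⟦ x ⟧ + ⟦ y ⟧ ≋ ⟦ z ⟧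
  OnLine⇒≋ z x y l = ≋-trans (≡⇒≋ (sym (ℤP.pos-+ (toℕ x) (toℕ y))))
    (%≡%⇒≋ (trans l (sym (m<n⇒m%n≡m (toℕ<n z)))))

  line-through : Fin p → Fin p → Fin p
  line-through x y = fromℕ< (m%n<n (toℕ x ℕ.+ toℕ y) p)

  OnLine-line-through : ∀ x y → OnLine (line-through x y) x y
  OnLine-line-through x y = sym (toℕ-fromℕ< _)

  OnLine-unique-z : ∀ {z z′} x y → OnLine z x y → OnLine z′ x y → z ≡ z′
  OnLine-unique-z x y l l′ = toℕ-injective (trans (sym l) l′)

  OnLine-unique-y : ∀ z x {y y′} → OnLine z x y → OnLine z x y′ → y ≡ y′
  OnLine-unique-y z x {y} {y′} l l′ =
    ⟦⟧-injective (+-cancelˡ-≋ {⟦ x ⟧} (≋-trans (OnLine⇒≋ z x y l) (≋-sym (OnLine⇒≋ z x y′ l′))))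

  Fibre-comm : ∀ z x y → Fibre z x y → Fibre z y x
  Fibre-comm z x y (h , l) =
    subst (λ s → s % p ≡ N % p) (ℕP.*-comm (toℕ x) (toℕ y)) h ,
    subst (λ s → s % p ≡ toℕ z) (ℕP.+-comm (toℕ x) (toℕ y)) l

  fibre-roots : ∀ z x₀ y₀ x y → Fibre z x₀ y₀ → Fibre z x y → x ≡ x₀ ⊎ x ≡ y₀
  fibre-roots z x₀ y₀ x y (h₀ , l₀) (h , l) = Sum.map ⟦⟧-injective ⟦⟧-injective (vieta
    (≋-trans (OnLine⇒≋ z x y l) (≋-sym (OnLine⇒≋ z x₀ y₀ l₀)))
    (≋-trans (InH⇒≋ x y h) (≋-sym (InH⇒≋ x₀ y₀ h₀))))

  root⇒row-nonempty : ∀ z x₀ y₀ x → Fibre z x₀ y₀ → x ≡ x₀ ⊎ x ≡ y₀ → ∃ (Fibre z x)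
  root⇒row-nonempty z x₀ y₀ x f₀ (inj₁ refl) = y₀ , f₀
  root⇒row-nonempty z x₀ y₀ x f₀ (inj₂ refl) = x₀ , Fibre-comm z x₀ y₀ f₀

  diagonal⇒double-root : ∀ z x₀ y₀ x → Fibre z x₀ y₀ → Fibre z x x → x ≡ x₀ × x ≡ y₀
  diagonal⇒double-root z x₀ y₀ x f₀ f = double (fibre-roots z x₀ y₀ x x f₀ f)
    where
    double : x ≡ x₀ ⊎ x ≡ y₀ → x ≡ x₀ × x ≡ y₀
    double (inj₁ refl) = refl , OnLine-unique-y z x {x} {y₀} (proj₂ f) (proj₂ f₀)
    double (inj₂ refl) = OnLine-unique-y z x {x} {x₀} (proj₂ f) (proj₂ (Fibre-comm z x₀ y₀ f₀)) , refl

  double-root⇒diagonal : ∀ z x₀ y₀ x → Fibre z x₀ y₀ → x ≡ x₀ × x ≡ y₀ → Fibre z x x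
  double-root⇒diagonal z x₀ y₀ x f₀ (refl , refl) = f₀

  neg : Fin p → Fin p
  neg x = [ - ⟦ x ⟧ ]

  InH-square-roots : ∀ x₀ x → InH N p x₀ x₀ → InH N p x x → x ≡ x₀ ⊎ x ≡ neg x₀
  InH-square-roots x₀ x h₀ h = Sum.map ⟦⟧-injective
    (λ x≋-x₀ → ⟦⟧-injective (≋-trans x≋-x₀ (≋-sym (⟦[a]⟧≋a (- ⟦ x₀ ⟧)))))
    (square-roots (≋-trans (InH⇒≋ x x h) (≋-sym (InH⇒≋ x₀ x₀ h₀))))

  InH-neg : ∀ x → InH N p x x → InH N p (neg x) (neg x)
  InH-neg x h = ≋⇒InH (neg x) (neg x) (begin
    ⟦ neg x ⟧ * ⟦ neg x ⟧  ≈⟨ *-cong (⟦[a]⟧≋a (- ⟦ x ⟧)) (⟦[a]⟧≋a (- ⟦ x ⟧)) ⟩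
    - ⟦ x ⟧ * - ⟦ x ⟧      ≡⟨ -a*-a≡a*a ⟦ x ⟧ ⟩
    ⟦ x ⟧ * ⟦ x ⟧          ≈⟨ InH⇒≋ x x h ⟩
    + N                    ∎)
    where
    open ≈-Reasoning ≋-setoid
    -a*-a≡a*a : ∀ a → - a * - a ≡ a * a
    -a*-a≡a*a = solve-∀

  module _ (N≄0 : ¬ (+ N ≋ 0ℤ)) where

    InH⇒≄0 : ∀ x y → InH N p x y → ¬ (⟦ x ⟧ ≋ 0ℤ)
    InH⇒≄0 x y h x≋0 = N≄0 (begin
      + N            ≈⟨ InH⇒≋ x y h ⟨
      ⟦ x ⟧ * ⟦ y ⟧  ≈⟨ *-cong x≋0 (≋-refl {⟦ y ⟧}) ⟩
      0ℤ * ⟦ y ⟧     ≡⟨ ℤP.*-zeroˡ ⟦ y ⟧ ⟩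
      0ℤ             ∎)
      where open ≈-Reasoning ≋-setoid

    InH-unique-y : ∀ x {y y′} → InH N p x y → InH N p x y′ → y ≡ y′
    InH-unique-y x {y} {y′} h h′ =
      ⟦⟧-injective (*-cancelˡ-≋ (InH⇒≄0 x y h) (≋-trans (InH⇒≋ x y h) (≋-sym (InH⇒≋ x y′ h′))))

    InH-exists : ∀ x → ¬ (⟦ x ⟧ ≋ 0ℤ) → ∃ (InH N p x)
    InH-exists x x≄0 with ⟦⟧-invertible x x≄0
    ... | k , xk≋1 = [ k * + N ] , ≋⇒InH x [ k * + N ] (begin
      ⟦ x ⟧ * ⟦ [ k * + N ] ⟧  ≈⟨ *-cong (≋-refl {⟦ x ⟧}) (⟦[a]⟧≋a (k * + N)) ⟩
      ⟦ x ⟧ * (k * + N)        ≡⟨ ℤP.*-assoc ⟦ x ⟧ k (+ N) ⟨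
      ⟦ x ⟧ * k * + N          ≈⟨ *-cong xk≋1 (≋-refl {+ N}) ⟩
      1ℤ * + N                 ≡⟨ ℤP.*-identityˡ (+ N) ⟩
      + N                      ∎)
      where open ≈-Reasoning ≋-setoid

    InH⇒≢neg : p % 2 ≡ 1 → ∀ x y → InH N p x y → x ≢ neg x
    InH⇒≢neg p-odd x y h x≡-x = InH⇒≄0 x y h (a≋-a⇒a≋0 p-odd
      (≋-trans (≡⇒≋ (cong ⟦_⟧ x≡-x)) (⟦[a]⟧≋a (- ⟦ x ⟧))))

open Data.Nat using (_+_; _*_; _∸_)
open Data.Fin.Subset using (∣_∣)
open MonoidSum ℕP.+-0-commutativeMonoid using (sum-syntax; ∑-comm; ∑-distrib-+; sum-cong-≗)

private variable
  a : Level
  A B : Set a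
  n : ℕ

𝟙 : Dec A → ℕ
𝟙 (yes _) = 1
𝟙 (no _) = 0

𝟙-⇔ : (A → B) → (B → A) → (A? : Dec A) (B? : Dec B) → 𝟙 A? ≡ 𝟙 B?
𝟙-⇔ A⇒B B⇒A (yes a) (yes b) = refl
𝟙-⇔ A⇒B B⇒A (yes a) (no ¬b) = contradiction (A⇒B a) ¬b
𝟙-⇔ A⇒B B⇒A (no ¬a) (yes b) = contradiction (B⇒A b) ¬a
𝟙-⇔ A⇒B B⇒A (no ¬a) (no ¬b) = refl

𝟙+𝟙-¬ : (A? : Dec A) → 𝟙 A? + 𝟙 (¬? A?) ≡ 1
𝟙+𝟙-¬ (yes _) = refl
𝟙+𝟙-¬ (no _) = refl

𝟙-⊎+𝟙-× : (A? : Dec A) (B? : Dec B) → 𝟙 (A? ⊎-dec B?) + 𝟙 (A? ×-dec B?) ≡ 𝟙 A? + 𝟙 B?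
𝟙-⊎+𝟙-× (yes _) (yes _) = refl
𝟙-⊎+𝟙-× (yes _) (no _) = refl
𝟙-⊎+𝟙-× (no _) (yes _) = refl
𝟙-⊎+𝟙-× (no _) (no _) = refl

𝟙-⊎-disjoint : ¬ (A × B) → (A? : Dec A) (B? : Dec B) → 𝟙 (A? ⊎-dec B?) ≡ 𝟙 A? + 𝟙 B?
𝟙-⊎-disjoint ¬A×B (yes a) (yes b) = contradiction (a , b) ¬A×B
𝟙-⊎-disjoint ¬A×B (yes _) (no _) = refl
𝟙-⊎-disjoint ¬A×B (no _) (yes _) = refl
𝟙-⊎-disjoint ¬A×B (no _) (no _) = refl

∣tabulate-does∣ : {P : Pred (Fin n) a} (P? : Decidable P) →
  ∣ tabulate (does ∘ P?) ∣ ≡ ∑[ i < n ] 𝟙 (P? i)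
∣tabulate-does∣ {zero} P? = refl
∣tabulate-does∣ {suc n} P? with P? zero
... | yes _ = cong suc (∣tabulate-does∣ (P? ∘ suc))
... | no _ = ∣tabulate-does∣ (P? ∘ suc)

∑-1 : ∀ n → ∑[ i < n ] 1 ≡ n
∑-1 zero = refl
∑-1 (suc n) = cong suc (∑-1 n)

∑𝟙+∑𝟙-¬ : {P : Pred (Fin n) a} (P? : Decidable P) →
  ∑[ i < n ] 𝟙 (P? i) + ∑[ i < n ] 𝟙 (¬? (P? i)) ≡ n
∑𝟙+∑𝟙-¬ {n = n} P? = begin
  ∑[ i < n ] 𝟙 (P? i) + ∑[ i < n ] 𝟙 (¬? (P? i))  ≡⟨ ∑-distrib-+ (𝟙 ∘ P?) (𝟙 ∘ ¬? ∘ P?) ⟨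
  ∑[ i < n ] (𝟙 (P? i) + 𝟙 (¬? (P? i)))          ≡⟨ sum-cong-≗ (𝟙+𝟙-¬ ∘ P?) ⟩
  ∑[ i < n ] 1                                   ≡⟨ ∑-1 n ⟩
  n                                              ∎
  where open ≡-Reasoning

∑𝟙-∅ : {P : Pred (Fin n) a} (P? : Decidable P) → (∀ i → ¬ P i) → ∑[ i < n ] 𝟙 (P? i) ≡ 0
∑𝟙-∅ {zero} P? ∅ = refl
∑𝟙-∅ {suc n} P? ∅ with P? zero
... | yes p = contradiction p (∅ zero)
... | no _ = ∑𝟙-∅ (P? ∘ suc) (∅ ∘ suc)

∑𝟙-≟ : (j : Fin n) → ∑[ i < n ] 𝟙 (i ≟ j) ≡ 1
∑𝟙-≟ {suc n} zero = cong suc (∑𝟙-∅ {n} (λ i → suc i ≟ zero) λ _ ())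
∑𝟙-≟ (suc j) =
  trans (sum-cong-≗ λ i → 𝟙-⇔ suc-injective (cong suc) (suc i ≟ suc j) (i ≟ j)) (∑𝟙-≟ j)

∑𝟙-subsingleton : {P : Pred (Fin n) a} (P? : Decidable P) → (∀ {i j} → P i → P j → i ≡ j) →
  (B? : Dec B) → (B → ∃ P) → (∃ P → B) → ∑[ i < n ] 𝟙 (P? i) ≡ 𝟙 B?
∑𝟙-subsingleton P? unique (no ¬b) B⇒∃P ∃P⇒B = ∑𝟙-∅ P? λ i p → ¬b (∃P⇒B (i , p))
∑𝟙-subsingleton P? unique (yes b) B⇒∃P ∃P⇒B with B⇒∃P b
... | j , pj = trans (sum-cong-≗ λ i → 𝟙-⇔ (λ pi → unique pi pj) (λ { refl → pj }) (P? i) (i ≟ j))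
                     (∑𝟙-≟ j)

module HyperbolaCount {p : ℕ} (p-prime : Prime p) (N : ℕ) where

  open PrimeCongruence p-prime
  open Hyperbola p-prime N

  line-count : ∀ x y → ∑[ z < p ] 𝟙 (Fibre? z x y) ≡ 𝟙 (InH? x y)
  line-count x y = ∑𝟙-subsingleton (λ z → Fibre? z x y)
    (λ f f′ → OnLine-unique-z x y (proj₂ f) (proj₂ f′))
    (InH? x y) (λ h → line-through x y , h , OnLine-line-through x y) (λ (_ , h , _) → h)

  row-count : ∀ z x → ∑[ y < p ] 𝟙 (Fibre? z x y) ≡ 𝟙 (any? (Fibre? z x))
  row-count z x = ∑𝟙-subsingleton (Fibre? z x)
    (λ {y} {y′} f f′ → OnLine-unique-y z x {y} {y′} (proj₂ f) (proj₂ f′))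
    (any? (Fibre? z x)) id id

  fibre-count : ∀ z (L? : Dec (InL N p z)) →
    ∑[ x < p ] ∑[ y < p ] 𝟙 (Fibre? z x y) + ∑[ x < p ] 𝟙 (Fibre? z x x) ≡ 𝟙 L? + 𝟙 L?
  fibre-count z (no ∉L) = cong₂ _+_
    (trans (sum-cong-≗ (row-count z)) (∑𝟙-∅ (any? ∘ Fibre? z) λ x (y , f) → ∉L (x , y , f)))
    (∑𝟙-∅ (λ x → Fibre? z x x) λ x f → ∉L (x , x , f))
  fibre-count z (yes (x₀ , y₀ , f₀)) = begin
    ∑[ x < p ] ∑[ y < p ] 𝟙 (Fibre? z x y) + ∑[ x < p ] 𝟙 (Fibre? z x x)
      ≡⟨ cong₂ _+_ (sum-cong-≗ row) (sum-cong-≗ diagonal) ⟩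
    ∑[ x < p ] 𝟙 (x ≟ x₀ ⊎-dec x ≟ y₀) + ∑[ x < p ] 𝟙 (x ≟ x₀ ×-dec x ≟ y₀)
      ≡⟨ ∑-distrib-+ (λ x → 𝟙 (x ≟ x₀ ⊎-dec x ≟ y₀)) (λ x → 𝟙 (x ≟ x₀ ×-dec x ≟ y₀)) ⟨
    ∑[ x < p ] (𝟙 (x ≟ x₀ ⊎-dec x ≟ y₀) + 𝟙 (x ≟ x₀ ×-dec x ≟ y₀))
      ≡⟨ sum-cong-≗ (λ x → 𝟙-⊎+𝟙-× (x ≟ x₀) (x ≟ y₀)) ⟩
    ∑[ x < p ] (𝟙 (x ≟ x₀) + 𝟙 (x ≟ y₀))
      ≡⟨ ∑-distrib-+ (λ x → 𝟙 (x ≟ x₀)) (λ x → 𝟙 (x ≟ y₀)) ⟩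
    ∑[ x < p ] 𝟙 (x ≟ x₀) + ∑[ x < p ] 𝟙 (x ≟ y₀)
      ≡⟨ cong₂ _+_ (∑𝟙-≟ x₀) (∑𝟙-≟ y₀) ⟩
    2 ∎
    where
    open ≡-Reasoning
    row : ∀ x → ∑[ y < p ] 𝟙 (Fibre? z x y) ≡ 𝟙 (x ≟ x₀ ⊎-dec x ≟ y₀)
    row x = trans (row-count z x) (𝟙-⇔ (λ (y , f) → fibre-roots z x₀ y₀ x y f₀ f)
                                       (root⇒row-nonempty z x₀ y₀ x f₀) _ _)
    diagonal : ∀ x → 𝟙 (Fibre? z x x) ≡ 𝟙 (x ≟ x₀ ×-dec x ≟ y₀)
    diagonal x = 𝟙-⇔ (diagonal⇒double-root z x₀ y₀ x f₀) (double-root⇒diagonal z x₀ y₀ x f₀) _ _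

  diagonal-total : ∑[ z < p ] ∑[ x < p ] 𝟙 (Fibre? z x x) ≡ ∑[ x < p ] 𝟙 (InH? x x)
  diagonal-total = trans (∑-comm (λ z x → 𝟙 (Fibre? z x x))) (sum-cong-≗ λ x → line-count x x)

  zero-count : ∑[ x < p ] 𝟙 (⟦ x ⟧ ≋? 0ℤ) ≡ 1
  zero-count = ∑𝟙-subsingleton (λ x → ⟦ x ⟧ ≋? 0ℤ)
    (λ x≋0 y≋0 → ⟦⟧-injective (≋-trans x≋0 (≋-sym y≋0)))
    (yes tt) (λ _ → [ 0ℤ ] , ⟦[a]⟧≋a 0ℤ) _

  ¬QR⇒squares-count : ¬ IsQR N p → ∑[ x < p ] 𝟙 (InH? x x) ≡ 0
  ¬QR⇒squares-count ¬QR = ∑𝟙-∅ (λ x → InH? x x) λ x h → ¬QR (x , h)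

  module _ (N≄0 : ¬ (+ N ≋ 0ℤ)) where

    hyperbola-row : ∀ x → ∑[ y < p ] 𝟙 (InH? x y) ≡ 𝟙 (¬? (⟦ x ⟧ ≋? 0ℤ))
    hyperbola-row x = ∑𝟙-subsingleton (InH? x) (InH-unique-y N≄0 x)
      (¬? (⟦ x ⟧ ≋? 0ℤ)) (InH-exists N≄0 x) (λ (y , h) → InH⇒≄0 N≄0 x y h)

    hyperbola-count : ∑[ x < p ] ∑[ y < p ] 𝟙 (InH? x y) ≡ p ∸ 1
    hyperbola-count = begin
      ∑[ x < p ] ∑[ y < p ] 𝟙 (InH? x y)  ≡⟨ sum-cong-≗ hyperbola-row ⟩
      nonzeros                            ≡⟨ ℕP.m+n∸m≡n 1 nonzeros ⟨
      1 + nonzeros ∸ 1                    ≡⟨ cong (λ k → k + nonzeros ∸ 1) zero-count ⟨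
      zeros + nonzeros ∸ 1                ≡⟨ cong (_∸ 1) (∑𝟙+∑𝟙-¬ (λ x → ⟦ x ⟧ ≋? 0ℤ)) ⟩
      p ∸ 1                               ∎
      where
      open ≡-Reasoning
      zeros nonzeros : ℕ
      zeros = ∑[ x < p ] 𝟙 (⟦ x ⟧ ≋? 0ℤ)
      nonzeros = ∑[ x < p ] 𝟙 (¬? (⟦ x ⟧ ≋? 0ℤ))

    fibres-total : ∑[ z < p ] ∑[ x < p ] ∑[ y < p ] 𝟙 (Fibre? z x y) ≡ p ∸ 1
    fibres-total = begin
      ∑[ z < p ] ∑[ x < p ] ∑[ y < p ] 𝟙 (Fibre? z x y)
        ≡⟨ ∑-comm (λ z x → ∑[ y < p ] 𝟙 (Fibre? z x y)) ⟩
      ∑[ x < p ] ∑[ z < p ] ∑[ y < p ] 𝟙 (Fibre? z x y)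
        ≡⟨ sum-cong-≗ (λ x → ∑-comm (λ z y → 𝟙 (Fibre? z x y))) ⟩
      ∑[ x < p ] ∑[ y < p ] ∑[ z < p ] 𝟙 (Fibre? z x y)
        ≡⟨ sum-cong-≗ (λ x → sum-cong-≗ (line-count x)) ⟩
      ∑[ x < p ] ∑[ y < p ] 𝟙 (InH? x y)
        ≡⟨ hyperbola-count ⟩
      p ∸ 1 ∎
      where open ≡-Reasoning

    ∣L∣+∣L∣ : ∣ Lset N p ∣ + ∣ Lset N p ∣ ≡ (p ∸ 1) + ∑[ x < p ] 𝟙 (InH? x x)
    ∣L∣+∣L∣ = begin
      ∣ Lset N p ∣ + ∣ Lset N p ∣
        ≡⟨ cong₂ _+_ (∣tabulate-does∣ (InL? N p)) (∣tabulate-does∣ (InL? N p)) ⟩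
      ∑[ z < p ] 𝟙 (InL? N p z) + ∑[ z < p ] 𝟙 (InL? N p z)
        ≡⟨ ∑-distrib-+ (λ z → 𝟙 (InL? N p z)) (λ z → 𝟙 (InL? N p z)) ⟨
      ∑[ z < p ] (𝟙 (InL? N p z) + 𝟙 (InL? N p z))
        ≡⟨ sum-cong-≗ (λ z → fibre-count z (InL? N p z)) ⟨
      ∑[ z < p ] (∑[ x < p ] ∑[ y < p ] 𝟙 (Fibre? z x y) + ∑[ x < p ] 𝟙 (Fibre? z x x))
        ≡⟨ ∑-distrib-+ (λ z → ∑[ x < p ] ∑[ y < p ] 𝟙 (Fibre? z x y)) (λ z → ∑[ x < p ] 𝟙 (Fibre? z x x)) ⟩
      ∑[ z < p ] ∑[ x < p ] ∑[ y < p ] 𝟙 (Fibre? z x y) + ∑[ z < p ] ∑[ x < p ] 𝟙 (Fibre? z x x)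
        ≡⟨ cong₂ _+_ fibres-total diagonal-total ⟩
      (p ∸ 1) + ∑[ x < p ] 𝟙 (InH? x x) ∎
      where open ≡-Reasoning

    QR⇒squares-count : p % 2 ≡ 1 → IsQR N p → ∑[ x < p ] 𝟙 (InH? x x) ≡ 2
    QR⇒squares-count p-odd (x₀ , h₀) = begin
      ∑[ x < p ] 𝟙 (InH? x x)
        ≡⟨ sum-cong-≗ (λ x → 𝟙-⇔ (InH-square-roots x₀ x h₀) (root⇒square x) _ _) ⟩
      ∑[ x < p ] 𝟙 (x ≟ x₀ ⊎-dec x ≟ neg x₀)
        ≡⟨ sum-cong-≗ (λ x → 𝟙-⊎-disjoint (λ (x≡x₀ , x≡-x₀) → x₀≢-x₀ (trans (sym x≡x₀) x≡-x₀))
                                          (x ≟ x₀) (x ≟ neg x₀)) ⟩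
      ∑[ x < p ] (𝟙 (x ≟ x₀) + 𝟙 (x ≟ neg x₀))
        ≡⟨ ∑-distrib-+ (λ x → 𝟙 (x ≟ x₀)) (λ x → 𝟙 (x ≟ neg x₀)) ⟩
      ∑[ x < p ] 𝟙 (x ≟ x₀) + ∑[ x < p ] 𝟙 (x ≟ neg x₀)
        ≡⟨ cong₂ _+_ (∑𝟙-≟ x₀) (∑𝟙-≟ (neg x₀)) ⟩
      2 ∎
      where
      open ≡-Reasoning
      x₀≢-x₀ : x₀ ≢ neg x₀
      x₀≢-x₀ = InH⇒≢neg N≄0 p-odd x₀ x₀ h₀
      root⇒square : ∀ x → x ≡ x₀ ⊎ x ≡ neg x₀ → InH N p x x
      root⇒square x (inj₁ refl) = h₀
      root⇒square x (inj₂ refl) = InH-neg x₀ h₀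

legendre≡1⇒QR : ∀ N p .{{_ : NonZero p}} → legendre N p ≡ 1ℤ → IsQR N p
legendre≡1⇒QR N p leg≡1 with N % p ℕP.≟ 0
... | yes _ with leg≡1
...   | ()
legendre≡1⇒QR N p leg≡1 | no _ with IsQR? N p
...   | yes qr = qr
...   | no _ with leg≡1
...     | ()

legendre≡-1⇒¬QR : ∀ N p .{{_ : NonZero p}} → legendre N p ≡ -1ℤ → ¬ IsQR N p
legendre≡-1⇒¬QR N p leg≡-1 with N % p ℕP.≟ 0
... | yes _ with leg≡-1
...   | ()
legendre≡-1⇒¬QR N p leg≡-1 | no _ with IsQR? N p
...   | no ¬qr = ¬qr
...   | yes _ with leg≡-1
...     | ()

n+n≡m⇒n≡m/2 : ∀ {n m} → n + n ≡ m → n ≡ m / 2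
n+n≡m⇒n≡m/2 {n} refl = begin
  n            ≡⟨ m*n/n≡m n 2 ⟨
  n * 2 / 2    ≡⟨ cong (_/ 2) (ℕP.*-comm n 2) ⟩
  2 * n / 2    ≡⟨ cong (λ k → (n + k) / 2) (ℕP.+-identityʳ n) ⟩
  (n + n) / 2  ∎
  where open ≡-Reasoning

lemma5p3 : (N r : ℕ) → (rp : Prime r) → r % 2 ≡ 1 → gcd N r ≡ 1 →
    (legendre N r {{prime⇒nonZero rp}} ≡ 1ℤ →
        ∣ Lset N r {{prime⇒nonZero rp}} ∣ ≡ (r + 1) / 2)
    × (legendre N r {{prime⇒nonZero rp}} ≡ -1ℤ →
        ∣ Lset N r {{prime⇒nonZero rp}} ∣ ≡ (r ∸ 1) / 2)
lemma5p3 N r rp r-odd gcd≡1 =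
  (λ leg≡1 → n+n≡m⇒n≡m/2 (begin
    ∣L∣ + ∣L∣          ≡⟨ ∣L∣+∣L∣ N≄0 ⟩
    (r ∸ 1) + squares  ≡⟨ cong (_+_ (r ∸ 1)) (QR⇒squares-count N≄0 r-odd (legendre≡1⇒QR N r leg≡1)) ⟩
    (r ∸ 1) + 2        ≡⟨ ℕP.+-suc (r ∸ 1) 1 ⟩
    suc (r ∸ 1) + 1    ≡⟨ cong (_+ 1) (ℕP.suc-pred r) ⟩
    r + 1              ∎))
  , (λ leg≡-1 → n+n≡m⇒n≡m/2 (begin
    ∣L∣ + ∣L∣          ≡⟨ ∣L∣+∣L∣ N≄0 ⟩
    (r ∸ 1) + squares  ≡⟨ cong (_+_ (r ∸ 1)) (¬QR⇒squares-count (legendre≡-1⇒¬QR N r leg≡-1)) ⟩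
    (r ∸ 1) + 0        ≡⟨ ℕP.+-identityʳ (r ∸ 1) ⟩
    r ∸ 1              ∎))
  where
  open ≡-Reasoning
  open PrimeCongruence rp
  open Hyperbola rp N
  open HyperbolaCount rp N
  N≄0 : ¬ (+ N ≋ 0ℤ)
  N≄0 = gcd≡1⇒≄0 gcd≡1
  ∣L∣ squares : ℕ
  ∣L∣ = ∣ Lset N r ∣
  squares = ∑[ x < r ] 𝟙 (InH? x x)
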